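{- Let $D=(V,A)$ be a loopless digraph with minimum in-degree at least $1$, and let $\mathcal{L}D=\mathcal{L}_{(A',\phi)}D$ be a partial line digraph of $D$. Then the Fibonacci number of $D$ is less than or equal to the Fibonacci number of $\mathcal{L}D$.
   Context: The Fibonacci number of a digraph is the number of its independent vertex sets (including the empty set), where a set $I$ is independent if $d(u,v)\ge 2$ for all distinct $u,v\in I$, $d$ denoting directed distance (length of a shortest directed path). For a vertex $x$, $\omega^-(x)$ is the set of arcs with terminal vertex $x$; for a set of arcs $\Omega$, $H(\Omega)=\{y:(x,y)\in\Omega\}$. An arc $(i,j)$ is written $ij$. Partial line digraph: take $A'\subseteq A$ and a surjective map $\phi:A\to A'$ such that (i) $H(A')=V$; (ii) $\phi|_{A'}$ is the identity, and for every $j\in V$, $\phi(\omega^-(j))\subseteq\omega^-(j)\cap A'$. Then $\mathcal{L}_{(A',\phi)}D$ has vertex set $A'$ and arc set $\{(ij,\phi(jk)): ij\in A',\ (j,k)\in A\}$. -}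

module Defs where

open import Data.Nat using (ℕ; zero; suc; _<_; z≤n; s≤s)
open import Data.Fin using (Fin; zero; suc; _≟_)
open import Data.Fin.Properties using (all?)
open import Data.Fin.Subset using (Subset; _∈_)
open import Data.Fin.Subset.Properties using (_∈?_)
open import Data.Bool using (Bool; true; false; _∧_)
open import Data.Bool.Properties using () renaming (_≟_ to _≟ᵇ_)
open import Data.List using (List; []; _∷_; map; _++_; filter; length; allFin)
open import Data.Bool.ListAction using (any)
open import Data.Vec using (_∷_; [])
open import Data.Product using (Σ; ∃; _×_; _,_; proj₁; proj₂)
open import Relation.Nullary using (¬_; Dec; yes; no)
open import Relation.Nullary.Decidable using (⌊_⌋; _→-dec_; _×-dec_; ¬?)
open import Relation.Binary.PropositionalEquality using (_≡_; refl)

record Digraph : Set where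
  field
    n   : ℕ
    adj : Fin n → Fin n → Bool
open Digraph public

Arc : (D : Digraph) → Fin (n D) → Fin (n D) → Set
Arc D u v = adj D u v ≡ true

Loopless : Digraph → Set
Loopless D = ∀ v → ¬ Arc D v v

MinInDegree≥1 : Digraph → Set
MinInDegree≥1 D = ∀ j → ∃ λ i → Arc D i j

data Walk (D : Digraph) : Fin (n D) → Fin (n D) → ℕ → Set where
  nil  : ∀ {u} → Walk D u u 0
  cons : ∀ {u w v k} → Arc D u w → Walk D w v k → Walk D u v (suc k)

-- d(u,v) ≥ 2 : there is no directed path (equivalently walk) of length < 2
Dist≥2 : (D : Digraph) → Fin (n D) → Fin (n D) → Set
Dist≥2 D u v = ∀ k → k < 2 → ¬ Walk D u v k

Independent : (D : Digraph) → Subset (n D) → Set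
Independent D I = ∀ u v → u ∈ I → v ∈ I → ¬ (u ≡ v) → Dist≥2 D u v

private
  dist-intro : (D : Digraph) {u v : Fin (n D)} → ¬ (u ≡ v) → ¬ Arc D u v → Dist≥2 D u v
  dist-intro D ne na .0 _ nil = ne refl
  dist-intro D ne na .1 _ (cons a nil) = na a
  dist-intro D ne na .(suc (suc _)) (s≤s (s≤s ())) (cons a (cons _ _))

  dist? : (D : Digraph) → ∀ u v → Dec (Dist≥2 D u v)
  dist? D u v with u ≟ v | adj D u v ≟ᵇ true
  ... | yes refl | _ = no λ d → d 0 (s≤s z≤n) nil
  ... | no _ | yes a = no λ d → d 1 (s≤s (s≤s z≤n)) (cons a nil)
  ... | no ne | no na = yes (dist-intro D ne na)

independent? : (D : Digraph) → (I : Subset (n D)) → Dec (Independent D I)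
independent? D I = all? λ u → all? λ v →
  (u ∈? I) →-dec (v ∈? I) →-dec ¬? (u ≟ v) →-dec dist? D u v

subsets : (k : ℕ) → List (Subset k)
subsets zero = [] ∷ []
subsets (suc k) = map (false ∷_) (subsets k) ++ map (true ∷_) (subsets k)

-- Fibonacci number: number of independent vertex sets (incl. the empty set)
fibonacci : Digraph → ℕ
fibonacci D = length (filter (independent? D) (subsets (n D)))

-- Partial line digraph data (A' , φ) of D.
-- A' is enumerated injectively by e : Fin m → arcs of D;
-- φ is given on all pairs but only its values on arcs matter.
record PartialLineData (D : Digraph) : Set where
  field
    m      : ℕ
    e      : Fin m → Fin (n D) × Fin (n D)
    e-arc  : ∀ a → Arc D (proj₁ (e a)) (proj₂ (e a))
    e-inj  : ∀ a b → e a ≡ e b → a ≡ b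
    φ      : Fin (n D) → Fin (n D) → Fin m
    φ-surj : ∀ a → ∃ λ i → ∃ λ j → Arc D i j × φ i j ≡ a
    H-A'   : ∀ v → ∃ λ a → proj₂ (e a) ≡ v
    φ-id   : ∀ a → φ (proj₁ (e a)) (proj₂ (e a)) ≡ a
    φ-in   : ∀ i j → Arc D i j → proj₂ (e (φ i j)) ≡ j
open PartialLineData public

-- L_(A',φ) D : vertices A', arcs (ij , φ(jk)) for ij ∈ A', jk ∈ A
partialLineDigraph : (D : Digraph) → PartialLineData D → Digraph
partialLineDigraph D P = record
  { n   = m P
  ; adj = λ a b → any (λ k → adj D (proj₂ (e P a)) k ∧ ⌊ φ P (proj₂ (e P a)) k ≟ b ⌋)
                      (allFin (n D))
  }

-- Send a vertex set I to ω⁻(I) ∩ A′, the arcs of A′ whose head lies in I. This is injective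
-- since every vertex is the head of an arc of A′. It preserves independence: an arc
-- ij → φ(jk) of 𝓛D comes from an arc jk of D whose head is also the head of φ(jk), so the
-- heads of adjacent vertices of 𝓛D are adjacent in D, or equal, which looplessness excludes.
module Submission where

open import Defs
open import Data.Nat using (_≤_; suc; z≤n; s≤s)
open import Data.Nat.Properties using (module ≤-Reasoning)
open import Data.Bool using (true; false)
open import Data.Bool.Properties using (T-≡; T-∧)
open import Data.Fin using (Fin; _≟_)
open import Data.Fin.Subset using (Subset; _⊆_) renaming (_∈_ to _∈ˢ_)
open import Data.Fin.Subset.Properties using (⊆-refl; ⊆-antisym)
open import Data.List using (List; []; _∷_; map; filter; length; allFin)
open import Data.List.Properties using (length-map; length-removeAt′)
open import Data.List.Relation.Unary.Any using (here; there; index; satisfied)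
open import Data.List.Relation.Unary.Any.Properties using (any⁻)
open import Data.List.Relation.Unary.All as All using ([])
open import Data.List.Relation.Unary.AllPairs using ([]; _∷_)
open import Data.List.Relation.Unary.Unique.Propositional using (Unique)
import Data.List.Relation.Unary.Unique.Propositional.Properties as Unique
open import Data.List.Membership.Propositional using (_∈_; _─_)
open import Data.List.Membership.Propositional.Properties
  using (∈-map⁺; ∈-map⁻; ∈-++⁺ˡ; ∈-++⁺ʳ; ∈-filter⁺; ∈-filter⁻)
open import Data.List.Relation.Binary.Subset.Propositional using () renaming (_⊆_ to _⊆ˡ_)
open import Data.Vec using (_∷_; []; lookup; tabulate)
open import Data.Vec.Properties using (lookup∘tabulate; []=⇒lookup; lookup⇒[]=)
open import Data.Empty using (⊥-elim)
open import Data.Product using (_×_; _,_; proj₂)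
open import Function using (_∘_; Injective)
open import Function.Bundles using (Equivalence)
open import Level using (Level)
open import Relation.Nullary using (¬_; yes; no)
open import Relation.Nullary.Decidable using (toWitness)
open import Relation.Unary using (Pred; Decidable)
open import Relation.Binary.PropositionalEquality using (_≡_; _≢_; refl; sym; trans; subst)

private
  variable
    a p q : Level
    A : Set a

∈-─⁺ : ∀ {x z : A} {ys} (x∈ys : x ∈ ys) → z ∈ ys → z ≢ x → z ∈ ys ─ x∈ys
∈-─⁺ (here refl) (here refl) z≢x = ⊥-elim (z≢x refl)
∈-─⁺ (here refl) (there z∈ys) _ = z∈ys
∈-─⁺ (there _) (here z≡y) _ = here z≡y
∈-─⁺ (there x∈ys) (there z∈ys) z≢x = there (∈-─⁺ x∈ys z∈ys z≢x)

Unique∧⊆⇒length≤ : ∀ {xs ys : List A} → Unique xs → xs ⊆ˡ ys → length xs ≤ length ys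
Unique∧⊆⇒length≤ {xs = []} _ _ = z≤n
Unique∧⊆⇒length≤ {xs = x ∷ xs} {ys} (x∉xs ∷ xs!) x∷xs⊆ys = begin
  suc (length xs)          ≤⟨ s≤s (Unique∧⊆⇒length≤ xs! xs⊆ys─x) ⟩
  suc (length (ys ─ x∈ys)) ≡⟨ length-removeAt′ ys (index x∈ys) ⟨
  length ys                ∎
  where
  open ≤-Reasoning
  x∈ys : x ∈ ys
  x∈ys = x∷xs⊆ys (here refl)
  xs⊆ys─x : xs ⊆ˡ ys ─ x∈ys
  xs⊆ys─x z∈xs = ∈-─⁺ x∈ys (x∷xs⊆ys (there z∈xs)) λ z≡x → All.lookup x∉xs z∈xs (sym z≡x)

∈-subsets : ∀ k (I : Subset k) → I ∈ subsets k
∈-subsets _ [] = here refl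
∈-subsets (suc k) (false ∷ I) = ∈-++⁺ˡ (∈-map⁺ (false ∷_) (∈-subsets k I))
∈-subsets (suc k) (true ∷ I) =
  ∈-++⁺ʳ (map (false ∷_) (subsets k)) (∈-map⁺ (true ∷_) (∈-subsets k I))

subsets-unique : ∀ k → Unique (subsets k)
subsets-unique 0 = [] ∷ []
subsets-unique (suc k) =
  Unique.++⁺ (Unique.map⁺ ∷-injective (subsets-unique k))
             (Unique.map⁺ ∷-injective (subsets-unique k))
             disjoint
  where
  ∷-injective : ∀ {b} {I J : Subset k} → b ∷ I ≡ b ∷ J → I ≡ J
  ∷-injective refl = refl
  disjoint : ∀ {I} → ¬ (I ∈ map (false ∷_) (subsets k) × I ∈ map (true ∷_) (subsets k))
  disjoint (I∈falses , I∈trues) with ∈-map⁻ (false ∷_) I∈falses | ∈-map⁻ (true ∷_) I∈trues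
  ... | _ , _ , refl | _ , _ , ()

filter-subsets-length-mono : ∀ {k l} {P : Pred (Subset k) p} {Q : Pred (Subset l) q}
  (P? : Decidable P) (Q? : Decidable Q) (g : Subset k → Subset l) → Injective _≡_ _≡_ g
  → (∀ {I} → P I → Q (g I))
  → length (filter P? (subsets k)) ≤ length (filter Q? (subsets l))
filter-subsets-length-mono {k = k} {l} P? Q? g g-injective g-preserves = begin
  length (filter P? (subsets k))           ≡⟨ length-map g (filter P? (subsets k)) ⟨
  length (map g (filter P? (subsets k)))   ≤⟨ Unique∧⊆⇒length≤ image-unique image⊆ ⟩
  length (filter Q? (subsets l))           ∎
  where
  open ≤-Reasoning
  image-unique : Unique (map g (filter P? (subsets k)))
  image-unique = Unique.map⁺ g-injective (Unique.filter⁺ P? (subsets-unique k))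
  image⊆ : map g (filter P? (subsets k)) ⊆ˡ filter Q? (subsets l)
  image⊆ gI∈image with I , I∈filter , refl ← ∈-map⁻ g gI∈image =
    ∈-filter⁺ Q? (∈-subsets l (g I)) (g-preserves (proj₂ (∈-filter⁻ P? {xs = subsets k} I∈filter)))

module _ (D : Digraph) (P : PartialLineData D) where

  private
    𝓛D : Digraph
    𝓛D = partialLineDigraph D P

  headOf : Fin (m P) → Fin (n D)
  headOf α = proj₂ (e P α)

  inArcs : Subset (n D) → Subset (m P)
  inArcs I = tabulate (lookup I ∘ headOf)

  lookup-inArcs : ∀ I α → lookup (inArcs I) α ≡ lookup I (headOf α)
  lookup-inArcs I = lookup∘tabulate (lookup I ∘ headOf)

  ∈-inArcs⁺ : ∀ {I α} → headOf α ∈ˢ I → α ∈ˢ inArcs I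
  ∈-inArcs⁺ {I} {α} h∈I = lookup⇒[]= α (inArcs I) (trans (lookup-inArcs I α) ([]=⇒lookup h∈I))

  ∈-inArcs⁻ : ∀ {I α} → α ∈ˢ inArcs I → headOf α ∈ˢ I
  ∈-inArcs⁻ {I} {α} α∈ = lookup⇒[]= (headOf α) I (trans (sym (lookup-inArcs I α)) ([]=⇒lookup α∈))

  inArcs-mono⁻ : ∀ {I J} → inArcs I ⊆ inArcs J → I ⊆ J
  inArcs-mono⁻ {I} sub {v} v∈I with α , refl ← H-A' P v = ∈-inArcs⁻ (sub (∈-inArcs⁺ {I} v∈I))

  inArcs-injective : Injective _≡_ _≡_ inArcs
  inArcs-injective {I} {J} eq = ⊆-antisym (inArcs-mono⁻ (subst (inArcs I ⊆_) eq ⊆-refl))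
                                          (inArcs-mono⁻ (subst (inArcs J ⊆_) (sym eq) ⊆-refl))

  arc⇒headArc : ∀ α β → Arc 𝓛D α β → Arc D (headOf α) (headOf β)
  arc⇒headArc α β α→β
    with k , α→β-via-k ← satisfied (any⁻ _ (allFin (n D)) (Equivalence.from T-≡ α→β))
    with jk , φjk≡β ← Equivalence.to T-∧ α→β-via-k
    with refl ← toWitness {a? = φ P (headOf α) k ≟ β} φjk≡β
    = subst (Arc D (headOf α)) (sym (φ-in P _ k arc)) arc
    where arc = Equivalence.to T-≡ jk

  inArcs-independent : Loopless D → ∀ {I} → Independent D I → Independent 𝓛D (inArcs I)
  inArcs-independent loopless I-indep α β α∈ β∈ α≢β 0 _ nil = α≢β refl
  inArcs-independent loopless I-indep α β α∈ β∈ α≢β 1 _ (cons α→β nil)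
    with headOf α ≟ headOf β | arc⇒headArc α β α→β
  ... | yes h≡h | arc = loopless (headOf α) (subst (Arc D (headOf α)) (sym h≡h) arc)
  ... | no h≢h | arc = I-indep _ _ (∈-inArcs⁻ α∈) (∈-inArcs⁻ β∈) h≢h 1 (s≤s (s≤s z≤n)) (cons arc nil)
  inArcs-independent loopless I-indep α β α∈ β∈ α≢β (suc (suc _)) (s≤s (s≤s ())) _

corollary2p2 : (D : Digraph) → Loopless D → MinInDegree≥1 D → (P : PartialLineData D)
    → fibonacci D ≤ fibonacci (partialLineDigraph D P)
corollary2p2 D loopless _ P =
  filter-subsets-length-mono (independent? D) (independent? (partialLineDigraph D P))
    (inArcs D P) (inArcs-injective D P) (inArcs-independent D P loopless)
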